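{- Let $k\ge0$ be an integer and $n=7+k$, and let $G=\mathcal{C}_n^+$, with cycle vertices $c_0,c_1,\dots,c_{n-1}$ in cyclic order and pendant vertex $p$ adjacent to $c_0$. Let $M=\mathrm{Diag}(\cdot)-A_G$ be the matrix whose diagonal entries are: $2$ at $p$; $2$ at $c_0,c_1,c_2$; $3$ at $c_3$; $2$ at $c_4,\dots,c_{3+k}$; $3$ at $c_{4+k}$; $2$ at $c_{5+k},c_{6+k}$. Let $R$ be the vector with entries: $2$ at $p$; $4$ at $c_0$; $3$ at $c_1$; $2$ at $c_2$; $1$ at $c_3,c_4,\dots,c_{3+k},c_{4+k}$; $2$ at $c_{5+k}$; $3$ at $c_{6+k}$. Then $(M,R)$ is an arithmetical structure on $G$ and its associated group $\Phi_M$ is cyclic of order $2k+5$.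
   Context: $\mathcal{C}_n^+$ is the graph on $n+1$ vertices obtained from the cycle on $n$ vertices by attaching one new vertex by a single edge to one vertex of the cycle. $A_G$ is the adjacency matrix of $G$. An arithmetical structure on a graph $G$ with vertices $v_1,\dots,v_m$ is a pair $(M,R)$ with $M=\mathrm{Diag}(a_1,\dots,a_m)-A_G$ for integers $a_i\ge1$ and $R$ a column vector of positive integers with $\gcd$ of entries $1$ such that $MR=0$; its associated group $\Phi_M$ is the torsion subgroup of $\mathbb{Z}^m/\mathrm{Im}(M)$. -}

module Defs where

open import Data.Nat as ℕ using (ℕ; zero; suc; _≡ᵇ_; _≤ᵇ_; NonZero; _%_)
open import Data.Nat.GCD using (gcd)
open import Data.Integer as ℤ using (ℤ; +_; _-_; _*_; _+_)
open import Data.Integer.Divisibility using () renaming (_∣_ to _∣ℤ_)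
open import Data.Fin using (Fin; zero; suc; toℕ)
open import Data.Bool using (Bool; true; false; if_then_else_; _∨_; _∧_)
open import Data.List using (List; foldr; map; allFin)
open import Data.Product using (Σ; ∃; _×_; _,_)
open import Function.Bundles using (_⇔_)
open import Relation.Binary.PropositionalEquality using (_≡_)

Σℤ : (m : ℕ) → (Fin m → ℤ) → ℤ
Σℤ zero    f = + 0
Σℤ (suc m) f = f zero + Σℤ m (λ i → f (suc i))

_·ᵥ_ : {m : ℕ} → (Fin m → Fin m → ℤ) → (Fin m → ℤ) → (Fin m → ℤ)
_·ᵥ_ {m} M x i = Σℤ m (λ j → M i j * x j)

gcdVec : (m : ℕ) → (Fin m → ℕ) → ℕ
gcdVec m R = foldr gcd 0 (map R (allFin m))

-- The graph C_n^+ on vertex set Fin (suc n):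
--   zero     = pendant vertex p
--   suc i    = cycle vertex c_i  (i = 0 … n-1), c_i ~ c_{i+1 mod n}
--   p ~ c_0

cycAdj : (n : ℕ) .{{_ : NonZero n}} → Fin n → Fin n → Bool
cycAdj n i j = ((suc (toℕ i) % n) ≡ᵇ toℕ j) ∨ ((suc (toℕ j) % n) ≡ᵇ toℕ i)

adjCnPlus : (n : ℕ) .{{_ : NonZero n}} → Fin (suc n) → Fin (suc n) → Bool
adjCnPlus n zero    zero    = false
adjCnPlus n zero    (suc j) = toℕ j ≡ᵇ 0
adjCnPlus n (suc i) zero    = toℕ i ≡ᵇ 0
adjCnPlus n (suc i) (suc j) = cycAdj n i j

adjMatrix : {m : ℕ} → (Fin m → Fin m → Bool) → Fin m → Fin m → ℤ
adjMatrix adj i j = if adj i j then + 1 else + 0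

diagMinus : {m : ℕ} → (Fin m → ℕ) → (Fin m → Fin m → ℤ) → Fin m → Fin m → ℤ
diagMinus {m} a A i j = (if toℕ i ≡ᵇ toℕ j then + (a i) else + 0) - A i j

IsArithmeticalStructure : (m : ℕ) → (Fin m → Fin m → Bool) → (Fin m → ℕ) → (Fin m → ℕ) → Set
IsArithmeticalStructure m adj a R =
  ((i : Fin m) → 1 ℕ.≤ a i) ×
  ((i : Fin m) → 0 ℕ.< R i) ×
  (gcdVec m R ≡ 1) ×
  ((i : Fin m) → (diagMinus a (adjMatrix adj) ·ᵥ (λ j → + (R j))) i ≡ + 0)

InIm : {m : ℕ} → (Fin m → Fin m → ℤ) → (Fin m → ℤ) → Set
InIm {m} M x = Σ (Fin m → ℤ) λ z → (i : Fin m) → (M ·ᵥ z) i ≡ x i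

_•_ : {m : ℕ} → ℤ → (Fin m → ℤ) → (Fin m → ℤ)
(c • x) i = c * x i

_−ᵥ_ : {m : ℕ} → (Fin m → ℤ) → (Fin m → ℤ) → (Fin m → ℤ)
(x −ᵥ y) i = x i - y i

IsTorsion : {m : ℕ} → (Fin m → Fin m → ℤ) → (Fin m → ℤ) → Set
IsTorsion M x = Σ ℕ λ d → (1 ℕ.≤ d) × InIm M ((+ d) • x)

TorsionCyclicOfOrder : {m : ℕ} → (Fin m → Fin m → ℤ) → ℕ → Set
TorsionCyclicOfOrder {m} M N =
  Σ (Fin m → ℤ) λ g →
    IsTorsion M g ×
    ((x : Fin m → ℤ) → IsTorsion M x → Σ ℤ λ j → InIm M (x −ᵥ (j • g))) ×
    ((j : ℤ) → InIm M (j • g) ⇔ ((+ N) ∣ℤ j))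

diagL33 : (k : ℕ) → Fin (suc (7 ℕ.+ k)) → ℕ
diagL33 k zero    = 2
diagL33 k (suc i) = if (toℕ i ≡ᵇ 3) ∨ (toℕ i ≡ᵇ 4 ℕ.+ k) then 3 else 2

RL33 : (k : ℕ) → Fin (suc (7 ℕ.+ k)) → ℕ
RL33 k zero    = 2
RL33 k (suc i) =
  if toℕ i ≡ᵇ 0 then 4 else
  if toℕ i ≡ᵇ 1 then 3 else
  if toℕ i ≡ᵇ 2 then 2 else
  if toℕ i ≤ᵇ 4 ℕ.+ k then 1 else
  if toℕ i ≡ᵇ 5 ℕ.+ k then 2 else 3

adjL33 : (k : ℕ) → Fin (suc (7 ℕ.+ k)) → Fin (suc (7 ℕ.+ k)) → Bool
adjL33 k = adjCnPlus (7 ℕ.+ k)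

ML33 : (k : ℕ) → Fin (suc (7 ℕ.+ k)) → Fin (suc (7 ℕ.+ k)) → ℤ
ML33 k = diagMinus (diagL33 k) (adjMatrix (adjL33 k))

{-# OPTIONS --safe #-}
-- Since M is symmetric and M R = 0, the pairing x ↦ R · x vanishes on Im M, hence on every torsion class.
-- Below the diagonal, the column of each cycle vertex c₁, …, c₅₊ₖ is minus the unit vector of the next
-- vertex, so adding multiples of these columns clears any x down to its entries at p, c₀, c₁; if moreover
-- R · x = 0, what remains is congruent to a multiple of g = −3 e_p + 2 e_c₁. An explicit z with M z = N g
-- (N = 2k + 5) shows that g is torsion, and an explicit w with M w ≡ 0 (mod N) and w · g = 2 shows that
-- j g ∈ Im M forces N ∣ 2j, hence N ∣ j since N is odd.
module Submission where

open import Defs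
open import Data.Nat as ℕ using (ℕ; zero; suc; _≡ᵇ_; _<ᵇ_; _%_; _≤_; _<_; z≤n; s≤s)
import Data.Nat.Properties as ℕP
import Data.Nat.DivMod as ℕD
import Data.Nat.Divisibility as ℕDiv
open import Data.Nat.GCD using (gcd; gcd[m,n]∣m; gcd[m,n]∣n)
open import Data.Integer using (ℤ; +_; -_; 0ℤ; 1ℤ; -1ℤ)
import Data.Integer.Properties as ℤP
import Data.Integer.Divisibility.Signed as ℤDiv
open import Data.Integer.Divisibility using () renaming (_∣_ to _∣ℤ_)
open import Data.Integer.Tactic.RingSolver using (solve-∀)
import Algebra.Properties.Semiring.Sum ℤP.+-*-semiring as Sum
open import Data.Fin using (Fin; zero; suc; toℕ; fromℕ<)
import Data.Fin.Properties as FinP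
open import Data.List using (List; _∷_; foldr; map; allFin)
open import Data.List.Relation.Unary.Any using (here; there)
open import Data.List.Membership.Propositional using (_∈_)
open import Data.List.Membership.Propositional.Properties using (∈-map⁺; ∈-allFin)
open import Data.Bool using (Bool; true; false; T; if_then_else_; _∨_)
open import Data.Bool.Properties using (if-float; if-eta; ∨-comm)
open import Data.Product using (Σ; _×_; _,_; proj₁)
open import Data.Sum using (_⊎_; inj₁; inj₂)
open import Data.Unit using (tt)
open import Function using (_∘_; _⇔_; mk⇔)
open import Relation.Nullary using (¬_; yes; no)
open import Relation.Nullary.Decidable using (dec-true; dec-false; does-⇔)
open import Relation.Nullary.Negation using (contradiction)
open import Relation.Binary.PropositionalEquality

if-preserves : ∀ {P : ℕ → Set} b {x y} → P x → P y → P (if b then x else y)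
if-preserves true  Px Py = Px
if-preserves false Px Py = Py

foldr-gcd-∣ : ∀ (xs : List ℕ) {x} → x ∈ xs → foldr gcd 0 xs ℕDiv.∣ x
foldr-gcd-∣ (y ∷ ys) (here refl) = gcd[m,n]∣m y (foldr gcd 0 ys)
foldr-gcd-∣ (y ∷ ys) (there x∈ys) = ℕDiv.∣-trans (gcd[m,n]∣n y (foldr gcd 0 ys)) (foldr-gcd-∣ ys x∈ys)

gcdVec-∣ : ∀ m (R : Fin m → ℕ) i → gcdVec m R ℕDiv.∣ R i
gcdVec-∣ m R i = foldr-gcd-∣ (map R (allFin m)) (∈-map⁺ R (∈-allFin i))

<3+⇒cases : ∀ {t j} → t < 3 ℕ.+ j → t < j ⊎ t ≡ j ⊎ t ≡ 1 ℕ.+ j ⊎ t ≡ 2 ℕ.+ j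
<3+⇒cases t<3+j with ℕP.m≤n⇒m<n∨m≡n (ℕP.≤-pred t<3+j)
... | inj₂ t≡2+j = inj₂ (inj₂ (inj₂ t≡2+j))
... | inj₁ t<2+j with ℕP.m≤n⇒m<n∨m≡n (ℕP.≤-pred t<2+j)
...   | inj₂ t≡1+j = inj₂ (inj₂ (inj₁ t≡1+j))
...   | inj₁ t<1+j with ℕP.m≤n⇒m<n∨m≡n (ℕP.≤-pred t<1+j)
...     | inj₂ t≡j = inj₂ (inj₁ t≡j)
...     | inj₁ t<j = inj₁ t<j

∀Fin⇒∀< : ∀ {m} (P : ℕ → Set) → (∀ (i : Fin m) → P (toℕ i)) → ∀ r → r < m → P r
∀Fin⇒∀< P P-toℕ r r<m = subst P (FinP.toℕ-fromℕ< r<m) (P-toℕ (fromℕ< r<m))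

extend : ∀ {m} → (Fin m → ℤ) → ℕ → ℤ
extend {zero}  x r       = 0ℤ
extend {suc m} x zero    = x zero
extend {suc m} x (suc r) = extend (x ∘ suc) r

extend-toℕ : ∀ {m} (x : Fin m → ℤ) i → extend x (toℕ i) ≡ x i
extend-toℕ x zero    = refl
extend-toℕ x (suc i) = extend-toℕ (x ∘ suc) i

module IndexedSums where
  open import Data.Integer using (_+_; _-_; _*_)
  open ≡-Reasoning

  Σℤ≡sum : ∀ m (f : Fin m → ℤ) → Σℤ m f ≡ Sum.sum f
  Σℤ≡sum zero    f = refl
  Σℤ≡sum (suc m) f = cong (_+_ (f zero)) (Σℤ≡sum m (f ∘ suc))

  ∑< : ℕ → (ℕ → ℤ) → ℤ
  ∑< m F = Sum.sum {m} (F ∘ toℕ)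

  syntax ∑< m (λ b → e) = ∑[ b < m ] e

  𝟙 : Bool → ℤ
  𝟙 b = if b then 1ℤ else 0ℤ

  δ : ℕ → ℕ → ℤ
  δ a b = 𝟙 (a ≡ᵇ b)

  δ-refl : ∀ a → δ a a ≡ 1ℤ
  δ-refl a = cong 𝟙 (dec-true (a ℕ.≟ a) refl)

  δ-≢ : ∀ {a b} → a ≢ b → δ a b ≡ 0ℤ
  δ-≢ {a} {b} a≢b = cong 𝟙 (dec-false (a ℕ.≟ b) a≢b)

  𝟙-∨ : ∀ b c → ¬ (T b × T c) → 𝟙 (b ∨ c) ≡ 𝟙 b + 𝟙 c
  𝟙-∨ true  true  both = contradiction (tt , tt) both
  𝟙-∨ true  false _    = refl
  𝟙-∨ false c     _    = sym (ℤP.+-identityˡ (𝟙 c))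

  if-then-0ℤ : ∀ b x → (if b then x else 0ℤ) ≡ 𝟙 b * x
  if-then-0ℤ true  x = sym (ℤP.*-identityˡ x)
  if-then-0ℤ false x = refl

  ∑-cong : ∀ m {F G : ℕ → ℤ} → (∀ b → b < m → F b ≡ G b) → ∑< m F ≡ ∑< m G
  ∑-cong m F≡G = Sum.sum-cong-≗ {m} (λ i → F≡G (toℕ i) (FinP.toℕ<n i))

  ∑-zero : ∀ m {F : ℕ → ℤ} → (∀ b → b < m → F b ≡ 0ℤ) → ∑< m F ≡ 0ℤ
  ∑-zero m F≡0 = trans (∑-cong m F≡0) (Sum.sum-replicate-zero m)

  ∑-distrib-+ : ∀ m (F G : ℕ → ℤ) → ∑[ b < m ] (F b + G b) ≡ ∑< m F + ∑< m G
  ∑-distrib-+ m F G = Sum.∑-distrib-+ {m} (F ∘ toℕ) (G ∘ toℕ)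

  *-distribˡ-∑ : ∀ m c (F : ℕ → ℤ) → c * ∑< m F ≡ ∑[ b < m ] (c * F b)
  *-distribˡ-∑ m c F = Sum.*-distribˡ-sum {m} c (F ∘ toℕ)

  ∑-distrib-- : ∀ m (F G : ℕ → ℤ) → ∑[ b < m ] (F b - G b) ≡ ∑< m F - ∑< m G
  ∑-distrib-- m F G = begin
    ∑[ b < m ] (F b - G b)           ≡⟨ ∑-cong m (λ b _ → cong (_+_ (F b)) (sym (ℤP.-1*i≡-i (G b)))) ⟩
    ∑[ b < m ] (F b + -1ℤ * G b)     ≡⟨ ∑-distrib-+ m F (λ b → -1ℤ * G b) ⟩
    ∑< m F + ∑[ b < m ] (-1ℤ * G b)  ≡⟨ cong (_+_ (∑< m F)) (sym (*-distribˡ-∑ m -1ℤ G)) ⟩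
    ∑< m F + -1ℤ * ∑< m G            ≡⟨ cong (_+_ (∑< m F)) (ℤP.-1*i≡-i (∑< m G)) ⟩
    ∑< m F - ∑< m G                  ∎

  ∑-comm : ∀ m p (H : ℕ → ℕ → ℤ) → ∑[ a < m ] ∑[ b < p ] H a b ≡ ∑[ b < p ] ∑[ a < m ] H a b
  ∑-comm m p H = Sum.∑-comm {m} {p} (λ i j → H (toℕ i) (toℕ j))

  ∑-δ : ∀ m {a} (F : ℕ → ℤ) → a < m → ∑[ b < m ] (δ a b * F b) ≡ F a
  ∑-δ (suc m) {zero} F _ = begin
    1ℤ * F 0 + ∑[ b < m ] (0ℤ * F (suc b))  ≡⟨ cong₂ _+_ (ℤP.*-identityˡ (F 0)) (∑-zero m (λ _ _ → refl)) ⟩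
    F 0 + 0ℤ                                ≡⟨ ℤP.+-identityʳ (F 0) ⟩
    F 0                                     ∎
  ∑-δ (suc m) {suc a} F (s≤s a<m) = trans (cong (_+_ 0ℤ) (∑-δ m (F ∘ suc) a<m)) (ℤP.+-identityˡ (F (suc a)))

module Matrices (m : ℕ) where
  open import Data.Integer using (_+_; _-_; _*_)
  open IndexedSums
  open ≡-Reasoning

  Vector : Set
  Vector = ℕ → ℤ

  Matrix : Set
  Matrix = ℕ → ℕ → ℤ

  infixl 7 _·_
  infix 7 _∙_

  _·_ : Matrix → Vector → Vector
  (M · X) r = ∑[ b < m ] (M r b * X b)

  _∙_ : Vector → Vector → ℤ
  X ∙ Y = ∑[ b < m ] (X b * Y b)

  Symmetric : Matrix → Set
  Symmetric M = ∀ a b → M a b ≡ M b a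

  InImage : Matrix → Vector → Set
  InImage M X = Σ Vector λ Z → ∀ r → r < m → (M · Z) r ≡ X r

  Congruent : Matrix → Vector → Vector → Set
  Congruent M X Y = InImage M (λ r → X r - Y r)

  ∙-scaleʳ : ∀ W c X → W ∙ (λ r → c * X r) ≡ c * (W ∙ X)
  ∙-scaleʳ W c X = trans (∑-cong m (λ b _ → swap (W b) c (X b))) (sym (*-distribˡ-∑ m c (λ b → W b * X b)))
    where
      swap : ∀ w c x → w * (c * x) ≡ c * (w * x)
      swap = solve-∀

  InImage-resp : ∀ M {X Y} → (∀ r → r < m → X r ≡ Y r) → InImage M X → InImage M Y
  InImage-resp M X≡Y (Z , MZ≡X) = Z , λ r r<m → trans (MZ≡X r r<m) (X≡Y r r<m)

  InImage-+ : ∀ M {X Y} → InImage M X → InImage M Y → InImage M (λ r → X r + Y r)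
  InImage-+ M {X} {Y} (Z , MZ≡X) (Z′ , MZ′≡Y) = (λ b → Z b + Z′ b) , λ r r<m → begin
    ∑[ b < m ] (M r b * (Z b + Z′ b))        ≡⟨ ∑-cong m (λ b _ → ℤP.*-distribˡ-+ (M r b) (Z b) (Z′ b)) ⟩
    ∑[ b < m ] (M r b * Z b + M r b * Z′ b)  ≡⟨ ∑-distrib-+ m (λ b → M r b * Z b) (λ b → M r b * Z′ b) ⟩
    (M · Z) r + (M · Z′) r                   ≡⟨ cong₂ _+_ (MZ≡X r r<m) (MZ′≡Y r r<m) ⟩
    X r + Y r                                ∎

  InImage-scale : ∀ M c {X} → InImage M X → InImage M (λ r → c * X r)
  InImage-scale M c {X} (Z , MZ≡X) = (λ b → c * Z b) , λ r r<m → begin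
    ∑[ b < m ] (M r b * (c * Z b))  ≡⟨ ∙-scaleʳ (M r) c Z ⟩
    c * (M · Z) r                   ≡⟨ cong (c *_) (MZ≡X r r<m) ⟩
    c * X r                         ∎

  InImage-column : ∀ M {a} c → a < m → InImage M (λ r → c * M r a)
  InImage-column M {a} c a<m = (λ b → c * δ a b) , λ r _ →
    trans (∑-cong m (λ b _ → swap (M r b) c (δ a b))) (∑-δ m (λ b → c * M r b) a<m)
    where
      swap : ∀ x c d → x * (c * d) ≡ d * (c * x)
      swap = solve-∀

  Congruent-refl : ∀ M X → Congruent M X X
  Congruent-refl M X = (λ _ → 0ℤ) , λ r _ →
    trans (∑-zero m (λ b _ → ℤP.*-zeroʳ (M r b))) (sym (ℤP.+-inverseʳ (X r)))

  Congruent-trans : ∀ M {X Y W} → Congruent M X Y → Congruent M Y W → Congruent M X W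
  Congruent-trans M {X} {Y} {W} X≡Y Y≡W =
    InImage-resp M (λ r _ → telescope (X r) (Y r) (W r)) (InImage-+ M X≡Y Y≡W)
    where
      telescope : ∀ x y w → (x - y) + (y - w) ≡ x - w
      telescope = solve-∀

  ·-self-adjoint : ∀ M → Symmetric M → ∀ W Z → W ∙ (M · Z) ≡ (M · W) ∙ Z
  ·-self-adjoint M M-sym W Z = begin
    ∑[ r < m ] (W r * ∑[ b < m ] (M r b * Z b))   ≡⟨ ∑-cong m (λ r _ → *-distribˡ-∑ m (W r) (λ b → M r b * Z b)) ⟩
    ∑[ r < m ] ∑[ b < m ] (W r * (M r b * Z b))  ≡⟨ ∑-comm m m (λ r b → W r * (M r b * Z b)) ⟩
    ∑[ b < m ] ∑[ r < m ] (W r * (M r b * Z b))  ≡⟨ ∑-cong m (λ b _ → ∑-cong m (λ r _ → transpose r b)) ⟩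
    ∑[ b < m ] ∑[ r < m ] (Z b * (M b r * W r))  ≡⟨ ∑-cong m (λ b _ → sym (*-distribˡ-∑ m (Z b) (λ r → M b r * W r))) ⟩
    ∑[ b < m ] (Z b * (M · W) b)                 ≡⟨ ∑-cong m (λ b _ → ℤP.*-comm (Z b) ((M · W) b)) ⟩
    (M · W) ∙ Z                                  ∎
    where
      rearrange : ∀ w x z → w * (x * z) ≡ z * (x * w)
      rearrange = solve-∀
      transpose : ∀ r b → W r * (M r b * Z b) ≡ Z b * (M b r * W r)
      transpose r b = trans (rearrange (W r) (M r b) (Z b)) (cong (λ x → Z b * (x * W r)) (M-sym r b))

  ∙-image : ∀ M → Symmetric M → ∀ {W c Q X} → (∀ r → r < m → (M · W) r ≡ c * Q r) →
            (im : InImage M X) → W ∙ X ≡ c * (Q ∙ proj₁ im)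
  ∙-image M M-sym {W} {c} {Q} {X} MW≡cQ (Z , MZ≡X) = begin
    W ∙ X
      ≡⟨ ∑-cong m (λ r r<m → cong (W r *_) (sym (MZ≡X r r<m))) ⟩
    W ∙ (M · Z)
      ≡⟨ ·-self-adjoint M M-sym W Z ⟩
    (M · W) ∙ Z
      ≡⟨ ∑-cong m (λ b b<m → trans (cong (_* Z b) (MW≡cQ b b<m)) (ℤP.*-assoc c (Q b) (Z b))) ⟩
    ∑[ b < m ] (c * (Q b * Z b))
      ≡⟨ sym (*-distribˡ-∑ m c (λ b → Q b * Z b)) ⟩
    c * (Q ∙ Z) ∎

  ∙-Congruent : ∀ M → Symmetric M → ∀ {R} → (∀ r → r < m → (M · R) r ≡ 0ℤ) →
                ∀ {X Y} → Congruent M X Y → R ∙ X ≡ R ∙ Y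
  ∙-Congruent M M-sym {R} MR≡0 {X} {Y} X≡Y = ℤP.i-j≡0⇒i≡j (R ∙ X) (R ∙ Y) (begin
    R ∙ X - R ∙ Y                       ≡⟨ sym (∑-distrib-- m (λ b → R b * X b) (λ b → R b * Y b)) ⟩
    ∑[ b < m ] (R b * X b - R b * Y b)  ≡⟨ ∑-cong m (λ b _ → sym (distrib (R b) (X b) (Y b))) ⟩
    R ∙ (λ b → X b - Y b)               ≡⟨ ∙-image M M-sym {R} {0ℤ} {R} MR≡0 X≡Y ⟩
    0ℤ                                  ∎)
    where
      distrib : ∀ r x y → r * (x - y) ≡ r * x - r * y
      distrib = solve-∀

  VanishFrom : ℕ → Vector → Set
  VanishFrom s X = ∀ u → s ≤ u → u < m → X u ≡ 0ℤ

  LowerBidiagonalFrom : ℕ → Matrix → Set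
  LowerBidiagonalFrom b M = ∀ a u → b ≤ a → a < u → u < m → M u a ≡ - δ (suc a) u

  clear-next : ∀ {M b a} → LowerBidiagonalFrom b M → b ≤ a → a < m → ∀ X → VanishFrom (suc (suc a)) X →
               Σ Vector λ X′ → VanishFrom (suc a) X′ × Congruent M X X′
  clear-next {M} {b} {a} lower b≤a a<m X X-vanish = X′ , X′-vanish , X≡X′
    where
      c : ℤ
      c = X (suc a)
      X′ : Vector
      X′ r = X r + c * M r a
      X≡X′ : Congruent M X X′
      X≡X′ = InImage-resp M (λ r _ → difference (X r) c (M r a)) (InImage-column M (- c) a<m)
        where
          difference : ∀ x c y → - c * y ≡ x - (x + c * y)
          difference = solve-∀
      cancel : ∀ x → x + x * - 1ℤ ≡ 0ℤ
      cancel = solve-∀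
      X′-vanish : VanishFrom (suc a) X′
      X′-vanish u a<u u<m with ℕP.m≤n⇒m<n∨m≡n a<u
      ... | inj₂ refl = begin
        c + c * M (suc a) a          ≡⟨ cong (λ y → c + c * y) (lower a (suc a) b≤a a<u u<m) ⟩
        c + c * - δ (suc a) (suc a)  ≡⟨ cong (λ y → c + c * - y) (δ-refl (suc a)) ⟩
        c + c * - 1ℤ                 ≡⟨ cancel c ⟩
        0ℤ                           ∎
      ... | inj₁ 1+a<u = begin
        X u + c * M u a         ≡⟨ cong₂ (λ x y → x + c * y) (X-vanish u 1+a<u u<m) (lower a u b≤a a<u u<m) ⟩
        0ℤ + c * - δ (suc a) u  ≡⟨ cong (λ y → 0ℤ + c * - y) (δ-≢ (ℕP.<⇒≢ 1+a<u)) ⟩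
        0ℤ + c * 0ℤ             ≡⟨ cong (_+_ 0ℤ) (ℤP.*-zeroʳ c) ⟩
        0ℤ                      ∎

  reduce-support : ∀ {M b} → LowerBidiagonalFrom b M → ∀ t X → VanishFrom (suc (t ℕ.+ b)) X →
                   Σ Vector λ Y → VanishFrom (suc b) Y × Congruent M X Y
  reduce-support {M} lower zero X X-vanish = X , X-vanish , Congruent-refl M X
  reduce-support {M} {b} lower (suc t) X X-vanish with t ℕ.+ b ℕ.<? m
  ... | no a≮m = reduce-support lower t X (λ u a<u u<m → contradiction (ℕP.<-trans a<u u<m) a≮m)
  ... | yes a<m with clear-next lower (ℕP.m≤n+m b t) a<m X X-vanish
  ...   | X′ , X′-vanish , X≡X′ with reduce-support lower t X′ X′-vanish
  ...     | Y , Y-vanish , X′≡Y = Y , Y-vanish , Congruent-trans M {X} {X′} {Y} X≡X′ X′≡Y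

  reduce-to-head : ∀ {M b} → LowerBidiagonalFrom b M → ∀ X →
                   Σ Vector λ Y → VanishFrom (suc b) Y × Congruent M X Y
  reduce-to-head {b = b} lower X = reduce-support lower m X
    (λ u m+b<u u<m → contradiction u<m (ℕP.<⇒≯ (ℕP.≤-<-trans (ℕP.m≤m+n m b) m+b<u)))

module Lemma33 (k : ℕ) where
  open import Data.Integer using (_+_; _-_; _*_)
  open IndexedSums
  open ≡-Reasoning

  n : ℕ
  n = 7 ℕ.+ k

  open Matrices (suc n)

  next : ℕ → ℕ
  next i = suc i % n

  prev : ℕ → ℕ
  prev zero    = 6 ℕ.+ k
  prev (suc i) = i

  next-suc : ∀ {i} → suc i < n → next i ≡ suc i
  next-suc = ℕD.m<n⇒m%n≡m

  next-last : next (6 ℕ.+ k) ≡ 0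
  next-last = ℕD.n%n≡0 n

  next<n : ∀ i → next i < n
  next<n i = ℕD.m%n<n (suc i) n

  prev<n : ∀ {i} → i < n → prev i < n
  prev<n {zero}  _     = ℕP.n<1+n (6 ℕ.+ k)
  prev<n {suc i} 1+i<n = ℕP.<-trans (ℕP.n<1+n i) 1+i<n

  next-prev : ∀ {i} → i < n → next (prev i) ≡ i
  next-prev {zero}  _     = next-last
  next-prev {suc i} 1+i<n = next-suc 1+i<n

  prev-next : ∀ {j} → j < n → prev (next j) ≡ j
  prev-next j<n with ℕP.m≤n⇒m<n∨m≡n (ℕP.≤-pred j<n)
  ... | inj₁ j<6+k = cong prev (next-suc (s≤s j<6+k))
  ... | inj₂ refl  = cong prev next-last

  next≢prev : ∀ {i} → i < n → next i ≢ prev i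
  next≢prev {zero}  _ ()
  next≢prev {suc i} 1+i<n with ℕP.m≤n⇒m<n∨m≡n (ℕP.≤-pred 1+i<n)
  ... | inj₁ 1+i<6+k = λ e → ℕP.<⇒≢ (ℕP.m<n⇒m<1+n (ℕP.n<1+n i)) (sym (trans (sym (next-suc (s≤s 1+i<6+k))) e))
  ... | inj₂ refl    = λ e → ℕP.0≢1+n (trans (sym next-last) e)

  next≡ᵇ : ∀ {i j} → i < n → j < n → (next j ≡ᵇ i) ≡ (prev i ≡ᵇ j)
  next≡ᵇ {i} {j} i<n j<n = does-⇔
    (mk⇔ (λ e → trans (cong prev (sym e)) (prev-next j<n)) (λ e → trans (cong next (sym e)) (next-prev i<n)))
    (next j ℕ.≟ i) (prev i ℕ.≟ j)

  d : ℕ → ℕ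
  d zero    = 2
  d (suc i) = if (i ≡ᵇ 3) ∨ (i ≡ᵇ 4 ℕ.+ k) then 3 else 2

  d-c₄₊ₖ : d (5 ℕ.+ k) ≡ 3
  d-c₄₊ₖ = cong (λ b → if b then 3 else 2) (dec-true (k ℕ.≟ k) refl)

  d-mid : ∀ {t} → t ≢ k → d (5 ℕ.+ t) ≡ 2
  d-mid {t} t≢k = cong (λ b → if b then 3 else 2) (dec-false (t ℕ.≟ k) t≢k)

  adjacent : ℕ → ℕ → Bool
  adjacent zero    zero    = false
  adjacent zero    (suc j) = j ≡ᵇ 0
  adjacent (suc i) zero    = i ≡ᵇ 0
  adjacent (suc i) (suc j) = (next i ≡ᵇ j) ∨ (next j ≡ᵇ i)

  adjacent-sym : ∀ a b → adjacent a b ≡ adjacent b a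
  adjacent-sym zero    zero    = refl
  adjacent-sym zero    (suc b) = refl
  adjacent-sym (suc a) zero    = refl
  adjacent-sym (suc a) (suc b) = ∨-comm (next a ≡ᵇ b) (next b ≡ᵇ a)

  M : Matrix
  M a b = (if a ≡ᵇ b then + d a else 0ℤ) - 𝟙 (adjacent a b)

  ML33≡M : ∀ i j → ML33 k i j ≡ M (toℕ i) (toℕ j)
  ML33≡M zero    zero    = refl
  ML33≡M zero    (suc j) = refl
  ML33≡M (suc i) zero    = refl
  ML33≡M (suc i) (suc j) = refl

  M-sym : Symmetric M
  M-sym a b with a ℕ.≟ b
  ... | yes refl = refl
  ... | no a≢b   = cong₂ _-_ (trans (off-diagonal a≢b) (sym (off-diagonal (a≢b ∘ sym)))) (cong 𝟙 (adjacent-sym a b))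
    where
      off-diagonal : ∀ {a b} → a ≢ b → (if a ≡ᵇ b then + d a else 0ℤ) ≡ 0ℤ
      off-diagonal {a} {b} a≢b = cong (λ c → if c then + d a else 0ℤ) (dec-false (a ℕ.≟ b) a≢b)

  M-cycle : ∀ {i j} → i < n → j < n → M (suc i) (suc j) ≡ δ i j * + d (suc i) - (δ (next i) j + δ (prev i) j)
  M-cycle {i} {j} i<n j<n = cong₂ _-_ (if-then-0ℤ (i ≡ᵇ j) (+ d (suc i))) (begin
    𝟙 ((next i ≡ᵇ j) ∨ (next j ≡ᵇ i))  ≡⟨ cong (λ b → 𝟙 ((next i ≡ᵇ j) ∨ b)) (next≡ᵇ i<n j<n) ⟩
    𝟙 ((next i ≡ᵇ j) ∨ (prev i ≡ᵇ j))  ≡⟨ 𝟙-∨ (next i ≡ᵇ j) (prev i ≡ᵇ j) not-both ⟩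
    δ (next i) j + δ (prev i) j        ∎)
    where
      not-both : ¬ (T (next i ≡ᵇ j) × T (prev i ≡ᵇ j))
      not-both (next≡j , prev≡j) = next≢prev i<n (trans (ℕP.≡ᵇ⇒≡ _ _ next≡j) (sym (ℕP.≡ᵇ⇒≡ _ _ prev≡j)))

  M-lower : LowerBidiagonalFrom 2 M
  M-lower (suc (suc a)) (suc u) (s≤s (s≤s _)) (s≤s 1+a<u) (s≤s u<n) = begin
    M (suc u) (2 ℕ.+ a)
      ≡⟨ M-sym (suc u) (2 ℕ.+ a) ⟩
    M (2 ℕ.+ a) (suc u)
      ≡⟨ M-cycle (ℕP.<-trans 1+a<u u<n) u<n ⟩
    δ (suc a) u * + d (2 ℕ.+ a) - (δ (next (suc a)) u + δ a u)
      ≡⟨ cong₂ (λ x y → x * + d (2 ℕ.+ a) - (δ y u + δ a u))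
               (δ-≢ (ℕP.<⇒≢ 1+a<u)) (next-suc (ℕP.≤-<-trans 1+a<u u<n)) ⟩
    0ℤ * + d (2 ℕ.+ a) - (δ (2 ℕ.+ a) u + δ a u)
      ≡⟨ cong (λ x → 0ℤ - (δ (2 ℕ.+ a) u + x)) (δ-≢ (ℕP.<⇒≢ (ℕP.<-trans (ℕP.n<1+n a) 1+a<u))) ⟩
    0ℤ - (δ (2 ℕ.+ a) u + 0ℤ)
      ≡⟨ simplify (δ (2 ℕ.+ a) u) ⟩
    - δ (2 ℕ.+ a) u ∎
    where
      simplify : ∀ x → 0ℤ - (x + 0ℤ) ≡ - x
      simplify = solve-∀

  ∑-cycle-row : ∀ (V : Vector) {i} → i < n →
    ∑[ j < n ] (M (suc i) (suc j) * V (suc j)) ≡ + d (suc i) * V (suc i) - (V (suc (next i)) + V (suc (prev i)))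
  ∑-cycle-row V {i} i<n = begin
    ∑[ j < n ] (M (suc i) (suc j) * V (suc j))
      ≡⟨ ∑-cong n entry ⟩
    ∑[ j < n ] (δ i j * (+ d (suc i) * V (suc j)) - (δ (next i) j * V (suc j) + δ (prev i) j * V (suc j)))
      ≡⟨ ∑-distrib-- n (λ j → δ i j * (+ d (suc i) * V (suc j)))
                       (λ j → δ (next i) j * V (suc j) + δ (prev i) j * V (suc j)) ⟩
    ∑[ j < n ] (δ i j * (+ d (suc i) * V (suc j))) - ∑[ j < n ] (δ (next i) j * V (suc j) + δ (prev i) j * V (suc j))
      ≡⟨ cong₂ _-_ (∑-δ n (λ j → + d (suc i) * V (suc j)) i<n)
                   (trans (∑-distrib-+ n (λ j → δ (next i) j * V (suc j)) (λ j → δ (prev i) j * V (suc j)))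
                          (cong₂ _+_ (∑-δ n (V ∘ suc) (next<n i)) (∑-δ n (V ∘ suc) (prev<n i<n)))) ⟩
    + d (suc i) * V (suc i) - (V (suc (next i)) + V (suc (prev i))) ∎
    where
      distribute : ∀ e d e′ e″ v → (e * d - (e′ + e″)) * v ≡ e * (d * v) - (e′ * v + e″ * v)
      distribute = solve-∀
      entry : ∀ j → j < n → M (suc i) (suc j) * V (suc j)
                            ≡ δ i j * (+ d (suc i) * V (suc j)) - (δ (next i) j * V (suc j) + δ (prev i) j * V (suc j))
      entry j j<n = trans (cong (_* V (suc j)) (M-cycle i<n j<n))
                          (distribute (δ i j) (+ d (suc i)) (δ (next i) j) (δ (prev i) j) (V (suc j)))

  row-p : ∀ (V : Vector) → (M · V) 0 ≡ + 2 * V 0 - V 1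
  row-p V = cong (_+_ (+ 2 * V 0)) (begin
    ∑[ j < n ] (M 0 (suc j) * V (suc j))    ≡⟨ ∑-cong n {λ j → M 0 (suc j) * V (suc j)} (λ j _ → pendant-row j) ⟩
    ∑[ j < n ] (-1ℤ * (δ 0 j * V (suc j)))  ≡⟨ sym (*-distribˡ-∑ n -1ℤ (λ j → δ 0 j * V (suc j))) ⟩
    -1ℤ * ∑[ j < n ] (δ 0 j * V (suc j))    ≡⟨ cong (-1ℤ *_) (∑-δ n (V ∘ suc) (s≤s z≤n)) ⟩
    -1ℤ * V 1                               ≡⟨ ℤP.-1*i≡-i (V 1) ⟩
    - V 1                                   ∎)
    where
      pendant-row : ∀ j → M 0 (suc j) * V (suc j) ≡ -1ℤ * (δ 0 j * V (suc j))
      pendant-row zero    = cong (-1ℤ *_) (sym (ℤP.*-identityˡ (V 1)))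
      pendant-row (suc j) = refl

  row-c₀ : ∀ (V : Vector) → (M · V) 1 ≡ + 2 * V 1 - V 2 - V (7 ℕ.+ k) - V 0
  row-c₀ V = begin
    -1ℤ * V 0 + ∑[ j < n ] (M 1 (suc j) * V (suc j))  ≡⟨ cong₂ _+_ (ℤP.-1*i≡-i (V 0)) (∑-cycle-row V (s≤s z≤n)) ⟩
    - V 0 + (+ 2 * V 1 - (V 2 + V (7 ℕ.+ k)))          ≡⟨ rearrange (V 0) (+ 2 * V 1) (V 2) (V (7 ℕ.+ k)) ⟩
    + 2 * V 1 - V 2 - V (7 ℕ.+ k) - V 0                ∎
    where
      rearrange : ∀ p x y z → - p + (x - (y + z)) ≡ x - y - z - p
      rearrange = solve-∀

  row-c : ∀ (V : Vector) {i} → suc i < n →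
          (M · V) (2 ℕ.+ i) ≡ + d (2 ℕ.+ i) * V (2 ℕ.+ i) - V (suc (next (suc i))) - V (suc i)
  row-c V {i} 1+i<n = begin
    0ℤ + ∑[ j < n ] (M (2 ℕ.+ i) (suc j) * V (suc j))
      ≡⟨ ℤP.+-identityˡ _ ⟩
    ∑[ j < n ] (M (2 ℕ.+ i) (suc j) * V (suc j))
      ≡⟨ ∑-cycle-row V 1+i<n ⟩
    + d (2 ℕ.+ i) * V (2 ℕ.+ i) - (V (suc (next (suc i))) + V (suc i))
      ≡⟨ rearrange (+ d (2 ℕ.+ i) * V (2 ℕ.+ i)) (V (suc (next (suc i)))) (V (suc i)) ⟩
    + d (2 ℕ.+ i) * V (2 ℕ.+ i) - V (suc (next (suc i))) - V (suc i) ∎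
    where
      rearrange : ∀ x y z → x - (y + z) ≡ x - y - z
      rearrange = solve-∀

  row-c≡ : ∀ (V : Vector) {i e x y z} → suc i < n →
           d (2 ℕ.+ i) ≡ e → V (2 ℕ.+ i) ≡ x → V (suc (next (suc i))) ≡ y → V (suc i) ≡ z →
           (M · V) (2 ℕ.+ i) ≡ + e * x - y - z
  row-c≡ V 1+i<n refl refl refl refl = row-c V 1+i<n

  -- Vertex p has index 0 and c_i has index i + 1; c₃₊ s is the entry at c_(3+s), for s ≤ k + 1.
  record Layout : Set where
    constructor layout
    field
      p c₀ c₁ c₂ : ℤ
      c₃₊ : ℕ → ℤ
      c₅₊ₖ c₆₊ₖ : ℤ

  vec : Layout → Vector
  vec (layout p _ _ _ _ _ _) 0 = p
  vec (layout _ c₀ _ _ _ _ _) 1 = c₀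
  vec (layout _ _ c₁ _ _ _ _) 2 = c₁
  vec (layout _ _ _ c₂ _ _ _) 3 = c₂
  vec (layout _ _ _ _ c₃₊ c₅₊ₖ c₆₊ₖ) (suc (suc (suc (suc s)))) =
    if s <ᵇ 2 ℕ.+ k then c₃₊ s else if s ≡ᵇ 2 ℕ.+ k then c₅₊ₖ else c₆₊ₖ

  vec-c₃₊ : ∀ A {s} → s < 2 ℕ.+ k → vec A (4 ℕ.+ s) ≡ Layout.c₃₊ A s
  vec-c₃₊ (layout _ _ _ _ c₃₊ c₅₊ₖ c₆₊ₖ) {s} s<2+k =
    cong (λ b → if b then c₃₊ s else if s ≡ᵇ 2 ℕ.+ k then c₅₊ₖ else c₆₊ₖ) (dec-true (s ℕ.<? 2 ℕ.+ k) s<2+k)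

  vec-c₅₊ₖ : ∀ A → vec A (6 ℕ.+ k) ≡ Layout.c₅₊ₖ A
  vec-c₅₊ₖ (layout _ _ _ _ c₃₊ c₅₊ₖ c₆₊ₖ) =
    cong₂ (λ b c → if b then c₃₊ (2 ℕ.+ k) else if c then c₅₊ₖ else c₆₊ₖ)
    (dec-false (2 ℕ.+ k ℕ.<? 2 ℕ.+ k) (ℕP.<-irrefl refl)) (dec-true (2 ℕ.+ k ℕ.≟ 2 ℕ.+ k) refl)

  vec-c₆₊ₖ : ∀ A → vec A (7 ℕ.+ k) ≡ Layout.c₆₊ₖ A
  vec-c₆₊ₖ (layout _ _ _ _ c₃₊ c₅₊ₖ c₆₊ₖ) =
    cong₂ (λ b c → if b then c₃₊ (3 ℕ.+ k) else if c then c₅₊ₖ else c₆₊ₖ)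
    (dec-false (3 ℕ.+ k ℕ.<? 2 ℕ.+ k) (ℕP.<-asym (ℕP.n<1+n _))) (dec-false (3 ℕ.+ k ℕ.≟ 2 ℕ.+ k) ℕP.1+n≢n)

  RowEquations : Layout → ℤ → Layout → Set
  RowEquations (layout p c₀ c₁ c₂ c₃₊ c₅₊ₖ c₆₊ₖ) κ (layout p′ c₀′ c₁′ c₂′ c₃₊′ c₅₊ₖ′ c₆₊ₖ′) =
    (+ 2 * p - c₀ ≡ κ * p′) ×
    (+ 2 * c₀ - c₁ - c₆₊ₖ - p ≡ κ * c₀′) ×
    (+ 2 * c₁ - c₂ - c₀ ≡ κ * c₁′) ×
    (+ 2 * c₂ - c₃₊ 0 - c₁ ≡ κ * c₂′) ×
    (+ 3 * c₃₊ 0 - c₃₊ 1 - c₂ ≡ κ * c₃₊′ 0) ×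
    (∀ s → s < k → + 2 * c₃₊ (suc s) - c₃₊ (2 ℕ.+ s) - c₃₊ s ≡ κ * c₃₊′ (suc s)) ×
    (+ 3 * c₃₊ (suc k) - c₅₊ₖ - c₃₊ k ≡ κ * c₃₊′ (suc k)) ×
    (+ 2 * c₅₊ₖ - c₆₊ₖ - c₃₊ (suc k) ≡ κ * c₅₊ₖ′) ×
    (+ 2 * c₆₊ₖ - c₀ - c₅₊ₖ ≡ κ * c₆₊ₖ′)

  ·-layout : ∀ A κ B → RowEquations A κ B → ∀ r → r < suc n → (M · vec A) r ≡ κ * vec B r
  ·-layout A κ B (e-p , e-c₀ , e-c₁ , e-c₂ , e-c₃ , e-mid , e-c₄₊ₖ , e-c₅₊ₖ , e-c₆₊ₖ) = rows
    where
      open Layout A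
      V : Vector
      V = vec A
      cycle-tail : ∀ t → 4 ℕ.+ t < n → t < k ⊎ t ≡ k ⊎ t ≡ 1 ℕ.+ k ⊎ t ≡ 2 ℕ.+ k →
                   (M · V) (5 ℕ.+ t) ≡ κ * vec B (5 ℕ.+ t)
      cycle-tail t 4+t<n (inj₁ t<k) =
        trans (row-c≡ V 4+t<n (d-mid (ℕP.<⇒≢ t<k))
                      (vec-c₃₊ A 1+t<2+k)
                      (trans (cong (V ∘ suc) (next-suc (s≤s (s≤s (s≤s (s≤s (s≤s t<2+k))))))) (vec-c₃₊ A (s≤s (s≤s t<k))))
                      (vec-c₃₊ A t<2+k))
              (trans (e-mid t t<k) (cong (κ *_) (sym (vec-c₃₊ B 1+t<2+k))))
        where
          1+t<2+k : suc t < 2 ℕ.+ k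
          1+t<2+k = s≤s (ℕP.m<n⇒m<1+n t<k)
          t<2+k : t < 2 ℕ.+ k
          t<2+k = ℕP.<-trans (ℕP.n<1+n t) 1+t<2+k
      cycle-tail _ 4+k<n (inj₂ (inj₁ refl)) =
        trans (row-c≡ V 4+k<n d-c₄₊ₖ
                      (vec-c₃₊ A ℕP.≤-refl)
                      (trans (cong (V ∘ suc) (next-suc (ℕP.m<n⇒m<1+n (ℕP.n<1+n _)))) (vec-c₅₊ₖ A))
                      (vec-c₃₊ A (ℕP.m<n⇒m<1+n (ℕP.n<1+n k))))
              (trans e-c₄₊ₖ (cong (κ *_) (sym (vec-c₃₊ B ℕP.≤-refl))))
      cycle-tail _ 5+k<n (inj₂ (inj₂ (inj₁ refl))) =
        trans (row-c≡ V 5+k<n (d-mid ℕP.1+n≢n)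
                      (vec-c₅₊ₖ A)
                      (trans (cong (V ∘ suc) (next-suc ℕP.≤-refl)) (vec-c₆₊ₖ A))
                      (vec-c₃₊ A ℕP.≤-refl))
              (trans e-c₅₊ₖ (cong (κ *_) (sym (vec-c₅₊ₖ B))))
      cycle-tail _ 6+k<n (inj₂ (inj₂ (inj₂ refl))) =
        trans (row-c≡ V 6+k<n (d-mid (ℕP.>⇒≢ (ℕP.m<n⇒m<1+n (ℕP.n<1+n k))))
                      (vec-c₆₊ₖ A)
                      (cong (V ∘ suc) next-last)
                      (vec-c₅₊ₖ A))
              (trans e-c₆₊ₖ (cong (κ *_) (sym (vec-c₆₊ₖ B))))
      rows : ∀ r → r < suc n → (M · V) r ≡ κ * vec B r
      rows 0 _ = trans (row-p V) e-p
      rows 1 _ = trans (trans (row-c₀ V) (cong (λ x → + 2 * c₀ - c₁ - x - p) (vec-c₆₊ₖ A))) e-c₀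
      rows 2 _ = trans (row-c V (s≤s (s≤s z≤n))) e-c₁
      rows 3 _ = trans (row-c V (s≤s (s≤s (s≤s z≤n)))) e-c₂
      rows 4 _ = trans (row-c V (s≤s (s≤s (s≤s (s≤s z≤n))))) e-c₃
      rows (suc (suc (suc (suc (suc t))))) (s≤s (s≤s (s≤s (s≤s (s≤s t<3+k))))) =
        cycle-tail t (s≤s (s≤s (s≤s (s≤s t<3+k)))) (<3+⇒cases t<3+k)

  K : ℤ
  K = + k

  N : ℤ
  N = + 2 * K + + 5

  N≡ : + (2 ℕ.* k ℕ.+ 5) ≡ N
  N≡ = cong (λ x → x + + 5) (ℤP.pos-* 2 k)

  R g z w q : Layout
  R = layout (+ 2) (+ 4) (+ 3) (+ 2) (λ _ → + 1) (+ 2) (+ 3)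
  g = layout (- + 3) 0ℤ (+ 2) 0ℤ (λ _ → 0ℤ) 0ℤ 0ℤ
  z = layout (- (K + + 3)) (+ 4 * K + + 9) (+ 6 * K + + 14) (+ 4 * K + + 9) (λ s → + 2 * K + + 4 - + s)
             (+ 2 * K + + 5) (+ 3 * K + + 7)
  w = layout 0ℤ 0ℤ 1ℤ (+ 2) (λ s → + 3 + + 4 * + s) (+ 8 * K + + 18) -1ℤ
  q = layout 0ℤ 0ℤ 0ℤ 0ℤ (λ _ → 0ℤ) (+ 6) (- + 4)

  M·R≡0 : ∀ r → r < suc n → (M · vec R) r ≡ 0ℤ
  M·R≡0 = ·-layout R 0ℤ R (refl , refl , refl , refl , refl , (λ _ _ → refl) , refl , refl , refl)

  M·z≡N·g : ∀ r → r < suc n → (M · vec z) r ≡ N * vec g r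
  M·z≡N·g = ·-layout z N g
    (at-p K , at-c₀ K , at-c₁ K , at-c₂ K , at-c₃ K , (λ s _ → at-mid K (+ s)) ,
     at-c₄₊ₖ K , at-c₅₊ₖ K , at-c₆₊ₖ K)
    where
      at-p : ∀ K → + 2 * - (K + + 3) - (+ 4 * K + + 9) ≡ (+ 2 * K + + 5) * - + 3
      at-p = solve-∀
      at-c₀ : ∀ K → + 2 * (+ 4 * K + + 9) - (+ 6 * K + + 14) - (+ 3 * K + + 7) - - (K + + 3) ≡ (+ 2 * K + + 5) * 0ℤ
      at-c₀ = solve-∀
      at-c₁ : ∀ K → + 2 * (+ 6 * K + + 14) - (+ 4 * K + + 9) - (+ 4 * K + + 9) ≡ (+ 2 * K + + 5) * + 2
      at-c₁ = solve-∀
      at-c₂ : ∀ K → + 2 * (+ 4 * K + + 9) - (+ 2 * K + + 4 - + 0) - (+ 6 * K + + 14) ≡ (+ 2 * K + + 5) * 0ℤ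
      at-c₂ = solve-∀
      at-c₃ : ∀ K → + 3 * (+ 2 * K + + 4 - + 0) - (+ 2 * K + + 4 - + 1) - (+ 4 * K + + 9) ≡ (+ 2 * K + + 5) * 0ℤ
      at-c₃ = solve-∀
      at-mid : ∀ K S → + 2 * (+ 2 * K + + 4 - (+ 1 + S)) - (+ 2 * K + + 4 - (+ 2 + S)) - (+ 2 * K + + 4 - S)
                        ≡ (+ 2 * K + + 5) * 0ℤ
      at-mid = solve-∀
      at-c₄₊ₖ : ∀ K → + 3 * (+ 2 * K + + 4 - (+ 1 + K)) - (+ 2 * K + + 5) - (+ 2 * K + + 4 - K) ≡ (+ 2 * K + + 5) * 0ℤ
      at-c₄₊ₖ = solve-∀
      at-c₅₊ₖ : ∀ K → + 2 * (+ 2 * K + + 5) - (+ 3 * K + + 7) - (+ 2 * K + + 4 - (+ 1 + K)) ≡ (+ 2 * K + + 5) * 0ℤ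
      at-c₅₊ₖ = solve-∀
      at-c₆₊ₖ : ∀ K → + 2 * (+ 3 * K + + 7) - (+ 4 * K + + 9) - (+ 2 * K + + 5) ≡ (+ 2 * K + + 5) * 0ℤ
      at-c₆₊ₖ = solve-∀

  M·w≡N·q : ∀ r → r < suc n → (M · vec w) r ≡ N * vec q r
  M·w≡N·q = ·-layout w N q
    (0≡N*0 , 0≡N*0 , 0≡N*0 , 0≡N*0 , 0≡N*0 , (λ s _ → at-mid K (+ s)) , at-c₄₊ₖ K , at-c₅₊ₖ K , at-c₆₊ₖ K)
    where
      0≡N*0 : 0ℤ ≡ N * 0ℤ
      0≡N*0 = sym (ℤP.*-zeroʳ N)
      at-mid : ∀ K S → + 2 * (+ 3 + + 4 * (+ 1 + S)) - (+ 3 + + 4 * (+ 2 + S)) - (+ 3 + + 4 * S) ≡ (+ 2 * K + + 5) * 0ℤ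
      at-mid = solve-∀
      at-c₄₊ₖ : ∀ K → + 3 * (+ 3 + + 4 * (+ 1 + K)) - (+ 8 * K + + 18) - (+ 3 + + 4 * K) ≡ (+ 2 * K + + 5) * 0ℤ
      at-c₄₊ₖ = solve-∀
      at-c₅₊ₖ : ∀ K → + 2 * (+ 8 * K + + 18) - -1ℤ - (+ 3 + + 4 * (+ 1 + K)) ≡ (+ 2 * K + + 5) * + 6
      at-c₅₊ₖ = solve-∀
      at-c₆₊ₖ : ∀ K → + 2 * -1ℤ - 0ℤ - (+ 8 * K + + 18) ≡ (+ 2 * K + + 5) * - + 4
      at-c₆₊ₖ = solve-∀

  g-vanish : ∀ s → vec g (3 ℕ.+ s) ≡ 0ℤ
  g-vanish zero    = refl
  g-vanish (suc s) =
    trans (cong (λ x → if s <ᵇ 2 ℕ.+ k then 0ℤ else x) (if-eta (s ≡ᵇ 2 ℕ.+ k))) (if-eta (s <ᵇ 2 ℕ.+ k))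

  w∙g≡2 : vec w ∙ vec g ≡ + 2
  w∙g≡2 = cong (λ t → 0ℤ + (0ℤ + (+ 2 + (0ℤ + t))))
    (∑-zero (4 ℕ.+ k) (λ s _ → trans (cong (vec w (4 ℕ.+ s) *_) (g-vanish (suc s))) (ℤP.*-zeroʳ (vec w (4 ℕ.+ s)))))

  head-congruent : ∀ Y → VanishFrom 3 Y → vec R ∙ Y ≡ 0ℤ →
                   Congruent M Y (λ r → (- Y 0 - + 2 * Y 1 - Y 2) * vec g r)
  head-congruent Y Y-vanish R∙Y≡0 = InImage-resp M column≡ (InImage-column M (- Y 1) (s≤s z≤n))
    where
      j : ℤ
      j = - Y 0 - + 2 * Y 1 - Y 2
      tail≡0 : ∑[ b < 5 ℕ.+ k ] (vec R (3 ℕ.+ b) * Y (3 ℕ.+ b)) ≡ 0ℤ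
      tail≡0 = ∑-zero (5 ℕ.+ k) (λ b b<5+k →
        trans (cong (vec R (3 ℕ.+ b) *_) (Y-vanish (3 ℕ.+ b) (s≤s (s≤s (s≤s z≤n))) (s≤s (s≤s (s≤s b<5+k)))))
              (ℤP.*-zeroʳ (vec R (3 ℕ.+ b))))
      relation : + 2 * Y 0 + (+ 4 * Y 1 + (+ 3 * Y 2 + 0ℤ)) ≡ 0ℤ
      relation = trans (cong (λ t → + 2 * Y 0 + (+ 4 * Y 1 + (+ 3 * Y 2 + t))) (sym tail≡0)) R∙Y≡0
      at-p : ∀ a b c → a - (- a - + 2 * b - c) * - + 3 ≡ - b * + 2 - (+ 2 * a + (+ 4 * b + (+ 3 * c + 0ℤ)))
      at-p = solve-∀
      at-c₀ : ∀ b j → - b * -1ℤ ≡ b - j * 0ℤ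
      at-c₀ = solve-∀
      at-c₁ : ∀ a b c → c - (- a - + 2 * b - c) * + 2 ≡ - b * 0ℤ + (+ 2 * a + (+ 4 * b + (+ 3 * c + 0ℤ)))
      at-c₁ = solve-∀
      beyond : ∀ b j → - b * 0ℤ ≡ 0ℤ - j * 0ℤ
      beyond = solve-∀
      column≡ : ∀ r → r < suc n → - Y 1 * M r 0 ≡ Y r - j * vec g r
      column≡ 0 _ =
        sym (trans (at-p (Y 0) (Y 1) (Y 2)) (trans (cong (λ t → - Y 1 * + 2 - t) relation) (ℤP.+-identityʳ _)))
      column≡ 1 _ = at-c₀ (Y 1) j
      column≡ 2 _ =
        sym (trans (at-c₁ (Y 0) (Y 1) (Y 2)) (trans (cong (_+_ (- Y 1 * 0ℤ)) relation) (ℤP.+-identityʳ _)))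
      column≡ (suc (suc (suc s))) 3+s<m = trans (beyond (Y 1) j)
        (sym (cong₂ (λ y h → y - j * h) (Y-vanish (3 ℕ.+ s) (s≤s (s≤s (s≤s z≤n))) 3+s<m) (g-vanish s)))

  generation : ∀ X → vec R ∙ X ≡ 0ℤ → Σ ℤ λ j → Congruent M X (λ r → j * vec g r)
  generation X R∙X≡0 with reduce-to-head M-lower X
  ... | Y , Y-vanish , X≡Y = - Y 0 - + 2 * Y 1 - Y 2 ,
    Congruent-trans M {X} {Y} X≡Y
      (head-congruent Y Y-vanish (trans (sym (∙-Congruent M M-sym {vec R} M·R≡0 {X} {Y} X≡Y)) R∙X≡0))

  torsion⊥R : ∀ d X → InImage M (λ r → + suc d * X r) → vec R ∙ X ≡ 0ℤ
  torsion⊥R d X dX∈Im = ℤP.*-cancelˡ-≡ (+ suc d) (vec R ∙ X) 0ℤ (begin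
    + suc d * (vec R ∙ X)              ≡⟨ sym (∙-scaleʳ (vec R) (+ suc d) X) ⟩
    vec R ∙ (λ r → + suc d * X r)      ≡⟨ ∙-image M M-sym {vec R} {0ℤ} {vec R} M·R≡0 dX∈Im ⟩
    0ℤ                                 ≡⟨ sym (ℤP.*-zeroʳ (+ suc d)) ⟩
    + suc d * 0ℤ                       ∎)

  -- (k + 3)·2 − N = 1, so N ∣ 2j forces N ∣ j.
  order : ∀ j → InImage M (λ r → j * vec g r) → N ℤDiv.∣ j
  order j jg∈Im = ℤDiv.divides ((K + + 3) * t - j) (begin
    j                                ≡⟨ bezout K j ⟩
    (K + + 3) * (j * + 2) - N * j    ≡⟨ cong (λ x → (K + + 3) * x - N * j) 2j≡Nt ⟩
    (K + + 3) * (N * t) - N * j      ≡⟨ factor K j t ⟩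
    ((K + + 3) * t - j) * N          ∎)
    where
      t : ℤ
      t = vec q ∙ proj₁ jg∈Im
      2j≡Nt : j * + 2 ≡ N * t
      2j≡Nt = begin
        j * + 2                        ≡⟨ cong (j *_) (sym w∙g≡2) ⟩
        j * (vec w ∙ vec g)            ≡⟨ sym (∙-scaleʳ (vec w) j (vec g)) ⟩
        vec w ∙ (λ r → j * vec g r)    ≡⟨ ∙-image M M-sym {vec w} {N} {vec q} M·w≡N·q jg∈Im ⟩
        N * t                          ∎
      bezout : ∀ K j → j ≡ (K + + 3) * (j * + 2) - (+ 2 * K + + 5) * j
      bezout = solve-∀
      factor : ∀ K j t → (K + + 3) * ((+ 2 * K + + 5) * t) - (+ 2 * K + + 5) * j
                         ≡ ((K + + 3) * t - j) * (+ 2 * K + + 5)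
      factor = solve-∀

  ·ᵥ≡· : ∀ {x} (V : Vector) → (∀ j → x j ≡ V (toℕ j)) → ∀ i → (ML33 k ·ᵥ x) i ≡ (M · V) (toℕ i)
  ·ᵥ≡· {x} V x≡V i = trans (Σℤ≡sum (suc n) (λ j → ML33 k i j * x j))
                           (Sum.sum-cong-≗ {suc n} (λ j → cong₂ _*_ (ML33≡M i j) (x≡V j)))

  InImage⇒InIm : ∀ {x F} → (∀ i → x i ≡ F (toℕ i)) → InImage M F → InIm (ML33 k) x
  InImage⇒InIm x≡F (Z , MZ≡F) = Z ∘ toℕ , λ i →
    trans (·ᵥ≡· Z (λ _ → refl) i) (trans (MZ≡F (toℕ i) (FinP.toℕ<n i)) (sym (x≡F i)))

  InIm⇒InImage : ∀ {x F} → (∀ i → x i ≡ F (toℕ i)) → InIm (ML33 k) x → InImage M F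
  InIm⇒InImage {x} {F} x≡F (z′ , Mz′≡x) = extend z′ , ∀Fin⇒∀< (λ r → (M · extend z′) r ≡ F r)
    (λ i → trans (sym (·ᵥ≡· (extend z′) (λ j → sym (extend-toℕ z′ j)) i)) (trans (Mz′≡x i) (x≡F i)))

  arithmetical-structure : IsArithmeticalStructure (suc (7 ℕ.+ k)) (adjL33 k) (diagL33 k) (RL33 k)
  arithmetical-structure = diagonal≥1 , R>0 , gcd≡1 , MR≡0
    where
      diagonal≥1 : ∀ i → 1 ≤ diagL33 k i
      diagonal≥1 zero    = s≤s z≤n
      diagonal≥1 (suc i) = if-preserves {1 ≤_} ((toℕ i ≡ᵇ 3) ∨ (toℕ i ≡ᵇ 4 ℕ.+ k)) (s≤s z≤n) (s≤s z≤n)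
      R>0 : ∀ i → 0 < RL33 k i
      R>0 zero    = s≤s z≤n
      R>0 (suc i) =
        if-preserves {0 <_} (toℕ i ≡ᵇ 0) (s≤s z≤n) (if-preserves {0 <_} (toℕ i ≡ᵇ 1) (s≤s z≤n)
          (if-preserves {0 <_} (toℕ i ≡ᵇ 2) (s≤s z≤n) (if-preserves {0 <_} (toℕ i ℕ.≤ᵇ 4 ℕ.+ k) (s≤s z≤n)
            (if-preserves {0 <_} (toℕ i ≡ᵇ 5 ℕ.+ k) (s≤s z≤n) (s≤s z≤n)))))
      gcd≡1 : gcdVec (suc (7 ℕ.+ k)) (RL33 k) ≡ 1
      gcd≡1 = ℕDiv.∣1⇒≡1 (ℕDiv.∣m+n∣m⇒∣n (gcdVec-∣ _ (RL33 k) (suc (suc zero))) (gcdVec-∣ _ (RL33 k) zero))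
      R-values : ∀ j → + RL33 k j ≡ vec R (toℕ j)
      R-values zero = refl
      R-values (suc zero) = refl
      R-values (suc (suc zero)) = refl
      R-values (suc (suc (suc zero))) = refl
      R-values (suc (suc (suc (suc j)))) = trans (if-float +_ (toℕ j <ᵇ 2 ℕ.+ k))
        (cong (λ x → if toℕ j <ᵇ 2 ℕ.+ k then + 1 else x) (if-float +_ (toℕ j ≡ᵇ 2 ℕ.+ k)))
      MR≡0 : ∀ i → (ML33 k ·ᵥ (λ j → + RL33 k j)) i ≡ 0ℤ
      MR≡0 i = trans (·ᵥ≡· (vec R) R-values i) (M·R≡0 (toℕ i) (FinP.toℕ<n i))

  torsion-cyclic : TorsionCyclicOfOrder (ML33 k) (2 ℕ.* k ℕ.+ 5)
  torsion-cyclic = vec g ∘ toℕ , g-torsion , generates , order-exact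
    where
      N·g∈Im : InImage M (λ r → N * vec g r)
      N·g∈Im = vec z , M·z≡N·g
      g-torsion : IsTorsion (ML33 k) (vec g ∘ toℕ)
      g-torsion = 2 ℕ.* k ℕ.+ 5 , ℕP.≤-trans (s≤s z≤n) (ℕP.m≤n+m 5 (2 ℕ.* k)) ,
                  InImage⇒InIm (λ i → cong (_* vec g (toℕ i)) N≡) N·g∈Im
      generates : ∀ x → IsTorsion (ML33 k) x → Σ ℤ λ j → InIm (ML33 k) (x −ᵥ (j • (vec g ∘ toℕ)))
      generates x (zero , () , _)
      generates x (suc d , _ , dx∈Im) =
        let (j , x≡jg) = generation (extend x) (torsion⊥R d (extend x) (InIm⇒InImage x-ext dx∈Im))
        in j , InImage⇒InIm (λ i → cong (λ y → y - j * vec g (toℕ i)) (sym (extend-toℕ x i))) x≡jg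
        where
          x-ext : ∀ i → + suc d * x i ≡ + suc d * extend x (toℕ i)
          x-ext i = cong (λ y → + suc d * y) (sym (extend-toℕ x i))
      multiple : ∀ {j} → + (2 ℕ.* k ℕ.+ 5) ℤDiv.∣ j → InImage M (λ r → j * vec g r)
      multiple (ℤDiv.divides c j≡cN) = InImage-resp M
        (λ r _ → trans (sym (ℤP.*-assoc c N (vec g r))) (cong (_* vec g r) (sym (trans j≡cN (cong (c *_) N≡)))))
        (InImage-scale M c N·g∈Im)
      order-exact : ∀ j → InIm (ML33 k) (j • (vec g ∘ toℕ)) ⇔ (+ (2 ℕ.* k ℕ.+ 5) ∣ℤ j)
      order-exact j = mk⇔
        (λ jg∈Im → ℤDiv.∣⇒∣ᵤ (subst (ℤDiv._∣ j) (sym N≡)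
                     (order j (InIm⇒InImage {F = λ r → j * vec g r} (λ _ → refl) jg∈Im))))
        (λ N∣j → InImage⇒InIm {F = λ r → j * vec g r} (λ _ → refl) (multiple {j} (ℤDiv.∣ᵤ⇒∣ N∣j)))

open import Data.Nat using (_+_; _*_)

lemma3p3 : (k : ℕ) →
    IsArithmeticalStructure (suc (7 + k)) (adjL33 k) (diagL33 k) (RL33 k) ×
    TorsionCyclicOfOrder (ML33 k) (2 * k + 5)
lemma3p3 k = Lemma33.arithmetical-structure k , Lemma33.torsion-cyclic k
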